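{- Let $\Sigma$ be an alphabet and $\mathbb{K}$ a set of languages over $\Sigma$. Then $\mathbb{K}$ is a parameterization if and only if all of the following hold: (1) $\mathbb{K}$ is closed under union; (2) $\mathbb{K}$ contains $\{w\}$ for every word $w\in\Sigma^*$; (3) there is a countable subset $\mathbb{K}'\subseteq\mathbb{K}$ such that the closure of $\mathbb{K}'$ under subsets equals $\mathbb{K}$.
   Context: A parameter over $\Sigma$ is a total function $\kappa\colon\Sigma^*\to\mathbb{N}$. For $c\in\mathbb{N}$ let $\kappa_c=\{w\in\Sigma^*:\kappa(w)\le c\}$. A language $L\subseteq\Sigma^*$ is bounded by $\kappa$ if $L\subseteq\kappa_c$ for some $c\in\mathbb{N}$; $\mathbb{K}(\kappa)$ denotes the set of languages bounded by $\kappa$. A set of languages $\mathbb{K}$ over $\Sigma$ is a parameterization if $\mathbb{K}=\mathbb{K}(\kappa)$ for some parameter $\kappa$ over $\Sigma$. The closure of a set of languages under subsets is the set of all subsets of its members. -}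

module Defs where

open import Data.Bool using (Bool; true; false; _∨_; if_then_else_)
open import Data.List using (List)
open import Data.Nat using (ℕ; _≤_)
open import Data.Fin using (Fin)
import Data.Fin as Fin
open import Data.Product using (Σ; ∃; _×_; _,_)
open import Data.Sum using (_⊎_)
open import Function.Bundles using (_↔_; Inverse)
open import Relation.Nullary using (¬_; Dec; yes; no; does)
open import Relation.Binary.Definitions using (DecidableEquality)
open import Relation.Binary.PropositionalEquality using (_≡_; refl; cong; sym; trans)

-- An alphabet: a finite set Σ, given with an enumeration Fin n ↔ A.
module _ {A : Set} {n : ℕ} (enum : Fin n ↔ A) where
  open Inverse enum

  alphabet-≟ : DecidableEquality A
  alphabet-≟ x y with from x Fin.≟ from y
  ... | yes p = yes (trans (sym (strictlyInverseˡ x)) (trans (cong to p) (strictlyInverseˡ y)))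
  ... | no ¬p = no (λ q → ¬p (cong from q))

Language : Set → Set
Language A = List A → Bool

LangSet : Set → Set₁
LangSet A = Language A → Set

module _ {A : Set} where

  _∈L_ : List A → Language A → Set
  w ∈L L = L w ≡ true

  _⊆L_ : Language A → Language A → Set
  L ⊆L M = ∀ w → w ∈L L → w ∈L M

  _≐_ : Language A → Language A → Set
  L ≐ M = ∀ w → L w ≡ M w

  _∪L_ : Language A → Language A → Language A
  (L ∪L M) w = L w ∨ M w

  Parameter : Set
  Parameter = List A → ℕ

  BoundedBy : Parameter → Language A → Set
  BoundedBy κ L = ∃ λ c → ∀ w → w ∈L L → κ w ≤ c

  IsParameterization : LangSet A → Set
  IsParameterization 𝕂 = ∃ λ (κ : Parameter) → ∀ L → (𝕂 L → BoundedBy κ L) × (BoundedBy κ L → 𝕂 L)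

  ClosedUnderUnion : LangSet A → Set
  ClosedUnderUnion 𝕂 = ∀ L M → 𝕂 L → 𝕂 M → 𝕂 (L ∪L M)

  Countable : LangSet A → Set
  Countable 𝕂' = (∀ L → ¬ 𝕂' L)
               ⊎ (Σ (ℕ → Language A) λ f → (∀ i → 𝕂' (f i)) × (∀ L → 𝕂' L → ∃ λ i → f i ≐ L))

  _⊆S_ : LangSet A → LangSet A → Set
  𝕂' ⊆S 𝕂 = ∀ L → 𝕂' L → 𝕂 L

  SubsetClosure : LangSet A → LangSet A
  SubsetClosure 𝕂' L = ∃ λ L' → 𝕂' L' × (L ⊆L L')

singleton : {A : Set} {n : ℕ} → Fin n ↔ A → List A → Language A
singleton enum w v = does (Data.List.Properties.≡-dec (alphabet-≟ enum) v w)
  where import Data.List.Properties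

-- If 𝕂 = 𝕂(κ), the levels κ_c form a countable family in 𝕂 whose subsets are exactly the
-- languages bounded by κ. Conversely, enumerate the countable basis as K₀, K₁, … and let κ(w)
-- be the least i with w ∈ Kᵢ, which exists because {w} ∈ 𝕂 lies below some Kᵢ. A member of 𝕂
-- lies below some Kⱼ and is therefore bounded by j; a language bounded by c lies below
-- K₀ ∪ … ∪ K_c, which is in 𝕂 by closure under union, so it is in 𝕂 as 𝕂 is closed under subsets.

module Submission where

open import Defs
open import Data.Bool using (Bool; true; false)
open import Data.Bool.Properties using (T-≡)
open import Data.Empty using (⊥-elim)
open import Data.Fin using (Fin)
open import Data.List using ([])
open import Data.List.Properties using (≡-dec)
open import Data.Nat using (ℕ; zero; suc; _≤_; z≤n; s≤s; s≤s⁻¹; _≤ᵇ_; _⊔_)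
open import Data.Nat.Properties using (≤ᵇ⇒≤; ≤⇒≤ᵇ; ≤-refl; ≤-trans; m≤m⊔n; m≤n⊔m; m≤n⇒m<n∨m≡n)
open import Data.Product using (Σ; ∃; _×_; _,_; proj₁; proj₂)
open import Data.Sum using (_⊎_; inj₁; inj₂)
open import Function.Bundles using (_↔_; Equivalence)
open import Relation.Nullary.Decidable using (yes; no; dec-true)
open import Relation.Binary.PropositionalEquality using (_≡_; refl; sym; trans; subst)

-- Linear search for the least i ≤ k with p i; it returns k when there is none.
least : (ℕ → Bool) → ℕ → ℕ
least p zero = zero
least p (suc k) with p zero
... | true = zero
... | false = suc (least (λ i → p (suc i)) k)

least-holds : ∀ (p : ℕ → Bool) k → p k ≡ true → p (least p k) ≡ true
least-holds p zero pk = pk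
least-holds p (suc k) pk with p zero in p0
... | true = p0
... | false = least-holds (λ i → p (suc i)) k pk

least-minimal : ∀ (p : ℕ → Bool) k j → p j ≡ true → least p k ≤ j
least-minimal p zero j pj = z≤n
least-minimal p (suc k) j pj with p zero in p0
... | true = z≤n
least-minimal p (suc k) zero pj | false with () ← trans (sym pj) p0
least-minimal p (suc k) (suc j) pj | false = s≤s (least-minimal (λ i → p (suc i)) k j pj)

module _ {A : Set} where

  ∈-∪⁻ : ∀ {w} (L M : Language A) → w ∈L (L ∪L M) → w ∈L L ⊎ w ∈L M
  ∈-∪⁻ {w} L M w∈ with L w
  ... | true = inj₁ refl
  ... | false = inj₂ w∈

  ∈-∪ˡ : ∀ {w} (L M : Language A) → w ∈L L → w ∈L (L ∪L M)
  ∈-∪ˡ {w} L M w∈L rewrite w∈L = refl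

  ∈-∪ʳ : ∀ {w} (L M : Language A) → w ∈L M → w ∈L (L ∪L M)
  ∈-∪ʳ {w} L M w∈M with L w
  ... | true = refl
  ... | false = w∈M

  ⊆L-trans : {L M N : Language A} → L ⊆L M → M ⊆L N → L ⊆L N
  ⊆L-trans L⊆M M⊆N w w∈L = M⊆N w (L⊆M w w∈L)

  ≐⇒⊆L : {L M : Language A} → L ≐ M → L ⊆L M
  ≐⇒⊆L L≐M w w∈L = trans (sym (L≐M w)) w∈L

  ⋃≤ : (ℕ → Language A) → ℕ → Language A
  ⋃≤ f zero = f zero
  ⋃≤ f (suc c) = ⋃≤ f c ∪L f (suc c)

  ⊆-⋃≤ : ∀ (f : ℕ → Language A) {i c} → i ≤ c → f i ⊆L ⋃≤ f c
  ⊆-⋃≤ f {zero} {zero} z≤n w w∈ = w∈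
  ⊆-⋃≤ f {i} {suc c} i≤1+c w w∈ with m≤n⇒m<n∨m≡n i≤1+c
  ... | inj₁ i<1+c = ∈-∪ˡ (⋃≤ f c) (f (suc c)) (⊆-⋃≤ f (s≤s⁻¹ i<1+c) w w∈)
  ... | inj₂ refl = ∈-∪ʳ (⋃≤ f c) (f (suc c)) w∈

  ⋃≤-closed : (𝕂 : LangSet A) → ClosedUnderUnion 𝕂 →
              ∀ f → (∀ i → 𝕂 (f i)) → ∀ c → 𝕂 (⋃≤ f c)
  ⋃≤-closed 𝕂 ∪-closed f f∈𝕂 zero = f∈𝕂 zero
  ⋃≤-closed 𝕂 ∪-closed f f∈𝕂 (suc c) =
    ∪-closed _ _ (⋃≤-closed 𝕂 ∪-closed f f∈𝕂 c) (f∈𝕂 (suc c))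

  Enumeration : LangSet A → Set
  Enumeration 𝕂' = Σ (ℕ → Language A) λ f → (∀ i → 𝕂' (f i)) × (∀ L → 𝕂' L → ∃ λ i → f i ≐ L)

  countable⇒enumeration : {𝕂' : LangSet A} → Countable 𝕂' → ∃ 𝕂' → Enumeration 𝕂'
  countable⇒enumeration (inj₁ empty) (L , L∈𝕂') = ⊥-elim (empty L L∈𝕂')
  countable⇒enumeration (inj₂ enum) _ = enum

  subsetClosure⇒⊆-enumerated : {𝕂' : LangSet A} ((f , _ , onto) : Enumeration 𝕂') →
                               ∀ {L} → SubsetClosure 𝕂' L → ∃ λ i → L ⊆L f i
  subsetClosure⇒⊆-enumerated (f , _ , onto) (L' , L'∈𝕂' , L⊆L') =
    let (i , fi≐L') = onto L' L'∈𝕂' in i , ⊆L-trans L⊆L' (≐⇒⊆L (λ w → sym (fi≐L' w)))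

module _ {A : Set} {n : ℕ} (enum : Fin n ↔ A) where

  ∈-singleton⁻ : ∀ {w v} → v ∈L singleton enum w → v ≡ w
  ∈-singleton⁻ {w} {v} with ≡-dec (alphabet-≟ enum) v w
  ... | yes v≡w = λ _ → v≡w
  ... | no _ = λ ()

  ∈-singleton : ∀ w → w ∈L singleton enum w
  ∈-singleton w = dec-true (≡-dec (alphabet-≟ enum) w w) refl

module ParameterLevels {A : Set} (κ : Parameter {A}) where

  level : ℕ → Language A
  level c w = κ w ≤ᵇ c

  ∈-level⁻ : ∀ {w c} → w ∈L level c → κ w ≤ c
  ∈-level⁻ {w} {c} w∈ = ≤ᵇ⇒≤ (κ w) c (Equivalence.from T-≡ w∈)

  ∈-level⁺ : ∀ {w c} → κ w ≤ c → w ∈L level c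
  ∈-level⁺ κw≤c = Equivalence.to T-≡ (≤⇒≤ᵇ κw≤c)

  Levels : LangSet A
  Levels L = ∃ λ c → level c ≐ L

  levels-enumeration : Enumeration Levels
  levels-enumeration = level , (λ c → c , λ _ → refl) , λ _ L∈ → L∈

  boundedBy⇒subsetClosure : ∀ {L} → BoundedBy κ L → SubsetClosure Levels L
  boundedBy⇒subsetClosure (c , bound) = level c , (c , λ _ → refl) , λ w w∈L → ∈-level⁺ (bound w w∈L)

  subsetClosure⇒boundedBy : ∀ {L} → SubsetClosure Levels L → BoundedBy κ L
  subsetClosure⇒boundedBy (L' , (c , levelc≐L') , L⊆L') =
    c , λ w w∈L → ∈-level⁻ (trans (levelc≐L' w) (L⊆L' w w∈L))

  boundedBy-∪ : ∀ {L M} → BoundedBy κ L → BoundedBy κ M → BoundedBy κ (L ∪L M)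
  boundedBy-∪ {L} {M} (c , bL) (d , bM) = c ⊔ d , bound
    where
    bound : ∀ w → w ∈L (L ∪L M) → κ w ≤ c ⊔ d
    bound w w∈ with ∈-∪⁻ L M w∈
    ... | inj₁ w∈L = ≤-trans (bL w w∈L) (m≤m⊔n c d)
    ... | inj₂ w∈M = ≤-trans (bM w w∈M) (m≤n⊔m c d)

  boundedBy-singleton : ∀ {n} (enum : Fin n ↔ A) w → BoundedBy κ (singleton enum w)
  boundedBy-singleton enum w =
    κ w , λ v v∈ → subst (λ u → κ u ≤ κ w) (sym (∈-singleton⁻ enum v∈)) ≤-refl

module FromEnumeration {A : Set} (𝕂 : LangSet A) (∪-closed : ClosedUnderUnion 𝕂)
    (⊆-closed : ∀ {L M} → L ⊆L M → 𝕂 M → 𝕂 L)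
    (f : ℕ → Language A) (f∈𝕂 : ∀ i → 𝕂 (f i))
    (⊆-generator : ∀ {L} → 𝕂 L → ∃ λ i → L ⊆L f i)
    (covering : ∀ w → ∃ λ i → w ∈L f i) where

  κ : Parameter
  κ w = least (λ i → f i w) (proj₁ (covering w))

  ∈-generator-κ : ∀ w → w ∈L f (κ w)
  ∈-generator-κ w = least-holds (λ i → f i w) (proj₁ (covering w)) (proj₂ (covering w))

  κ-minimal : ∀ {w i} → w ∈L f i → κ w ≤ i
  κ-minimal {w} {i} w∈ = least-minimal (λ j → f j w) (proj₁ (covering w)) i w∈

  isParameterization : IsParameterization 𝕂
  isParameterization = κ , λ L → bounded L , bounded⇒∈ L
    where
    bounded : ∀ L → 𝕂 L → BoundedBy κ L
    bounded L L∈𝕂 = let (i , L⊆fi) = ⊆-generator L∈𝕂 in i , λ w w∈L → κ-minimal (L⊆fi w w∈L)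

    bounded⇒∈ : ∀ L → BoundedBy κ L → 𝕂 L
    bounded⇒∈ L (c , bound) = ⊆-closed L⊆⋃ (⋃≤-closed 𝕂 ∪-closed f f∈𝕂 c)
      where
      L⊆⋃ : L ⊆L ⋃≤ f c
      L⊆⋃ w w∈L = ⊆-⋃≤ f (bound w w∈L) w (∈-generator-κ w)

module Characterization {A : Set} {n : ℕ} (enum : Fin n ↔ A) (𝕂 : LangSet A) where

  CountableBasis : LangSet A → Set
  CountableBasis 𝕂' = Countable 𝕂' × (𝕂' ⊆S 𝕂)
                      × (∀ L → (SubsetClosure 𝕂' L → 𝕂 L) × (𝕂 L → SubsetClosure 𝕂' L))

  ParameterizationAxioms : Set₁
  ParameterizationAxioms =
    ClosedUnderUnion 𝕂 × (∀ w → 𝕂 (singleton enum w)) × ∃ CountableBasis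

  parameterization⇒axioms : IsParameterization 𝕂 → ParameterizationAxioms
  parameterization⇒axioms (κ , 𝕂⇔bounded) =
    (λ L M L∈𝕂 M∈𝕂 → bounded⇒∈ (boundedBy-∪ (∈⇒bounded L∈𝕂) (∈⇒bounded M∈𝕂)))
    , (λ w → bounded⇒∈ (boundedBy-singleton enum w))
    , Levels , inj₂ levels-enumeration
    , (λ L L∈ → bounded⇒∈ (subsetClosure⇒boundedBy (L , L∈ , λ _ w∈ → w∈)))
    , λ L → (λ L∈ → bounded⇒∈ (subsetClosure⇒boundedBy L∈))
          , (λ L∈𝕂 → boundedBy⇒subsetClosure (∈⇒bounded L∈𝕂))
    where
    open ParameterLevels κ

    ∈⇒bounded : ∀ {L} → 𝕂 L → BoundedBy κ L
    ∈⇒bounded = proj₁ (𝕂⇔bounded _)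

    bounded⇒∈ : ∀ {L} → BoundedBy κ L → 𝕂 L
    bounded⇒∈ = proj₂ (𝕂⇔bounded _)

  axioms⇒parameterization : ParameterizationAxioms → IsParameterization 𝕂
  axioms⇒parameterization (∪-closed , singleton∈𝕂 , 𝕂' , countable , 𝕂'⊆𝕂 , 𝕂≡closure) =
    FromEnumeration.isParameterization 𝕂 ∪-closed ⊆-closed f (λ i → 𝕂'⊆𝕂 _ (f∈𝕂' i)) ⊆-generator covering
    where
    closure⁺ : ∀ {L} → 𝕂 L → SubsetClosure 𝕂' L
    closure⁺ = proj₂ (𝕂≡closure _)

    ⊆-closed : ∀ {L M} → L ⊆L M → 𝕂 M → 𝕂 L
    ⊆-closed L⊆M M∈𝕂 =
      let (M' , M'∈𝕂' , M⊆M') = closure⁺ M∈𝕂 in proj₁ (𝕂≡closure _) (M' , M'∈𝕂' , ⊆L-trans L⊆M M⊆M')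

    -- 𝕂' is nonempty because 𝕂 contains {ε}.
    enumeration : Enumeration 𝕂'
    enumeration =
      let (L' , L'∈𝕂' , _) = closure⁺ (singleton∈𝕂 []) in countable⇒enumeration countable (L' , L'∈𝕂')

    f : ℕ → Language A
    f = proj₁ enumeration

    f∈𝕂' : ∀ i → 𝕂' (f i)
    f∈𝕂' = proj₁ (proj₂ enumeration)

    ⊆-generator : ∀ {L} → 𝕂 L → ∃ λ i → L ⊆L f i
    ⊆-generator L∈𝕂 = subsetClosure⇒⊆-enumerated enumeration (closure⁺ L∈𝕂)

    covering : ∀ w → ∃ λ i → w ∈L f i
    covering w = let (i , [w]⊆fi) = ⊆-generator (singleton∈𝕂 w) in i , [w]⊆fi w (∈-singleton enum w)

theorem7p4 : {A : Set} (n : ℕ) (enum : Fin n ↔ A) (𝕂 : LangSet A) →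
    (IsParameterization 𝕂 →
      ClosedUnderUnion 𝕂
      × (∀ w → 𝕂 (singleton enum w))
      × (∃ λ (𝕂' : LangSet A) → Countable 𝕂' × (𝕂' ⊆S 𝕂)
          × (∀ L → (SubsetClosure 𝕂' L → 𝕂 L) × (𝕂 L → SubsetClosure 𝕂' L))))
    × (ClosedUnderUnion 𝕂
      × (∀ w → 𝕂 (singleton enum w))
      × (∃ λ (𝕂' : LangSet A) → Countable 𝕂' × (𝕂' ⊆S 𝕂)
          × (∀ L → (SubsetClosure 𝕂' L → 𝕂 L) × (𝕂 L → SubsetClosure 𝕂' L)))
      → IsParameterization 𝕂)
theorem7p4 n enum 𝕂 = parameterization⇒axioms , axioms⇒parameterization
  where open Characterization enum 𝕂
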